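{- Let $f\colon\mathbb{N}^2\to\mathbb{N}$ be any max-dominating pairing function. Define $\xi_f$ on $\mathbb{N}$ by $\xi_f(0)=()$ and, for each pair $(x,y)\in\mathbb{N}^2$, $$\xi_f(f(x,y)+1)=\begin{cases} (y) & \text{if } x=0,\\ (\xi_f(x),y) & \text{otherwise},\end{cases}$$ where $(y)$ is the length-one sequence and, if $\xi_f(x)=(v_1,\ldots,v_k)$, then $(\xi_f(x),y)$ denotes the sequence $(v_1,\ldots,v_k,y)$. Then $\xi_f$ is an enumeration of $\mathbb{N}^*$, i.e. a bijection from $\mathbb{N}$ onto $\mathbb{N}^*$.
   Context: $\mathbb{N}$ denotes the set of non-negative integers. A pairing function for $\mathbb{N}$ is a bijection $\mathbb{N}^2\to\mathbb{N}$; it is max-dominating if $\max(x,y)\le f(x,y)$ for all $(x,y)$. $\mathbb{N}^*=\{()\}\cup\mathbb{N}^1\cup\mathbb{N}^2\cup\cdots$ is the set of all finite-length sequences of non-negative integers, where $()$ is the empty sequence; sequences of different lengths are distinct elements of $\mathbb{N}^*$. (Since $x\le f(x,y)<f(x,y)+1$, the recursion defining $\xi_f$ refers only to smaller arguments.) -}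

module Defs where

open import Data.Nat using (ℕ; zero; suc; _+_; _≤_; _<_; _⊔_; s≤s)
open import Data.Nat.Properties using (m≤m⊔n; ≤-trans; ≤-reflexive)
open import Data.Nat.Induction using (<-rec)
open import Data.Product using (_×_; _,_; proj₁; proj₂)
open import Data.List using (List; []; _∷_; [_]; _++_)
open import Function.Definitions using (Bijective)
open import Relation.Binary.PropositionalEquality using (_≡_; refl)

IsPairing : (ℕ × ℕ → ℕ) → Set
IsPairing f = Bijective _≡_ _≡_ f

MaxDominating : (ℕ × ℕ → ℕ) → Set
MaxDominating f = ∀ x y → x ⊔ y ≤ f (x , y)

-- ℕ* (finite sequences of naturals) is represented by List ℕ;
-- (ξ(x), y) is  ξ x ++ [ y ].

module Xi (f : ℕ × ℕ → ℕ) (pf : IsPairing f) (md : MaxDominating f) where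

  unpair : ℕ → ℕ × ℕ
  unpair m = proj₁ (proj₂ pf m)

  unpair-correct : ∀ m → f (unpair m) ≡ m
  unpair-correct m = proj₂ (proj₂ pf m) refl

  fst-small : ∀ m → proj₁ (unpair m) < suc m
  fst-small m with unpair m | unpair-correct m
  ... | (x , y) | eq = s≤s (≤-trans (m≤m⊔n x y) (≤-trans (md x y) (≤-reflexive eq)))

  ξ : ℕ → List ℕ
  ξ = <-rec (λ _ → List ℕ) step
    where
    step : ∀ n → (∀ {k} → k < n → List ℕ) → List ℕ
    step zero    rec = []
    step (suc m) rec with unpair m | fst-small m
    ... | (zero  , y) | _ = [ y ]
    ... | (suc x , y) | p = rec {suc x} p ++ [ y ]

ξ_ : (f : ℕ × ℕ → ℕ) → IsPairing f → MaxDominating f → ℕ → List ℕ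
ξ_ f pf md = Xi.ξ f pf md

-- Writing (x , y) = f⁻¹(m), both clauses of the definition of ξ_f collapse
-- into the single recursion
--     ξ_f (0) = (),    ξ_f (m + 1) = ξ_f (x) ++ (y),
-- because ξ_f (0) ++ (y) = (y).  Since f is a bijection this says that
-- ξ_f (f (x , y) + 1) = ξ_f (x) ++ (y) for every pair (x , y), and
-- max-domination makes x < m + 1, so the recursion is well founded.
--
-- Injectivity then
-- follows by strong induction: ξ_f (0) is the only empty sequence, and
-- ξ_f (m + 1) = ξ_f (n + 1) forces equal last entries and, by induction,
-- equal prefixes, hence f⁻¹(m) = f⁻¹(n).  Surjectivity follows by induction
-- on a list viewed from its right end: if ξ_f (a) = xs then
-- ξ_f (f (a , y) + 1) = xs ++ (y).
module Submission where

open import Defs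
open import Data.Nat using (ℕ)
open import Data.Product using (_×_)
open import Data.List using (List)
open import Function.Definitions using (Bijective)
open import Relation.Binary.PropositionalEquality using (_≡_)

open import Data.Nat using (zero; suc; _<_; _<′_; <′-base; <′-step)
open import Data.Nat.Properties using (<⇒<′)
open import Data.Nat.Induction using (<′-wellFounded; <′-wellFounded′; <-rec)
open import Data.Product using (_,_; proj₁; proj₂; ∃)
open import Data.Product.Properties using (×-≡,≡→≡)
open import Data.List using ([]; _∷_; [_]; _++_)
open import Data.List.Properties using (∷ʳ-injective; ++-conicalʳ)
open import Data.List.Reverse using (Reverse; []; _∶_∶ʳ_; reverseView)
open import Data.Empty using (⊥-elim)
open import Function.Consequences.Propositional using (strictlySurjective⇒surjective)
open import Relation.Nullary using (¬_)
open import Relation.Binary.PropositionalEquality using (refl; sym; trans; cong)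

-- Descending along any chain k <′ n, the library's accessibility proof for
-- n hands down the canonical accessibility proof of k.  This is what makes
-- a recursive call of a function defined by <-rec compute to the function
-- itself at the smaller argument.
<′-wellFounded′-canonical : ∀ {k n} (k<′n : k <′ n) →
                            <′-wellFounded′ n k<′n ≡ <′-wellFounded k
<′-wellFounded′-canonical <′-base          = refl
<′-wellFounded′-canonical (<′-step k<′n) = <′-wellFounded′-canonical k<′n

snoc≢[] : ∀ (xs : List ℕ) y → ¬ (xs ++ [ y ] ≡ [])
snoc≢[] xs y eq with () ← ++-conicalʳ xs [ y ] eq

module Enumeration (f : ℕ × ℕ → ℕ) (pf : IsPairing f) (md : MaxDominating f) where
  open Xi f pf md using (unpair; unpair-correct; fst-small) renaming (ξ to ξᶠ)

  unpair-pair : ∀ p → unpair (f p) ≡ p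
  unpair-pair p = proj₁ pf (unpair-correct (f p))

  unpair-injective : ∀ {m n} → unpair m ≡ unpair n → m ≡ n
  unpair-injective {m} {n} eq =
    trans (sym (unpair-correct m)) (trans (cong f eq) (unpair-correct n))

  ξ-suc : ∀ m → ξᶠ (suc m) ≡ ξᶠ (proj₁ (unpair m)) ++ [ proj₂ (unpair m) ]
  ξ-suc m with unpair m | fst-small m
  ... | (zero  , y) | _   = refl
  ... | (suc x , y) | x<m rewrite <′-wellFounded′-canonical (<⇒<′ x<m) = refl

  ξ-pair : ∀ x y → ξᶠ (suc (f (x , y))) ≡ ξᶠ x ++ [ y ]
  ξ-pair x y = trans (ξ-suc (f (x , y)))
                     (cong (λ p → ξᶠ (proj₁ p) ++ [ proj₂ p ]) (unpair-pair (x , y)))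

  ξ-suc≢[] : ∀ m → ¬ (ξᶠ (suc m) ≡ [])
  ξ-suc≢[] m eq = snoc≢[] _ _ (trans (sym (ξ-suc m)) eq)

  -- Injectivity, by strong induction on the first argument: equal nonempty
  -- values have equal last entries and equal prefixes, and the prefixes come
  -- from strictly smaller arguments.
  ξ-injective : ∀ a b → ξᶠ a ≡ ξᶠ b → a ≡ b
  ξ-injective = <-rec (λ a → ∀ b → ξᶠ a ≡ ξᶠ b → a ≡ b) step
    where
    step : ∀ a → (∀ {k} → k < a → ∀ b → ξᶠ k ≡ ξᶠ b → k ≡ b) →
           ∀ b → ξᶠ a ≡ ξᶠ b → a ≡ b
    step zero    _  zero    _  = refl
    step zero    _  (suc n) eq = ⊥-elim (ξ-suc≢[] n (sym eq))
    step (suc m) _  zero    eq = ⊥-elim (ξ-suc≢[] m eq)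
    step (suc m) IH (suc n) eq =
      cong suc (unpair-injective (×-≡,≡→≡ (IH (fst-small m) _ same-prefix , same-last)))
      where
      x x′ y y′ : ℕ
      x  = proj₁ (unpair m)
      x′ = proj₁ (unpair n)
      y  = proj₂ (unpair m)
      y′ = proj₂ (unpair n)

      split : ξᶠ x ≡ ξᶠ x′ × y ≡ y′
      split = ∷ʳ-injective _ _ (trans (sym (ξ-suc m)) (trans eq (ξ-suc n)))

      same-prefix : ξᶠ x ≡ ξᶠ x′
      same-prefix = proj₁ split

      same-last : y ≡ y′
      same-last = proj₂ split

  ξ-hits : ∀ {xs} → Reverse xs → ∃ λ a → ξᶠ a ≡ xs
  ξ-hits []                = zero , refl
  ξ-hits (xs ∶ rxs ∶ʳ y) with a , ξa≡xs ← ξ-hits rxs =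
    suc (f (a , y)) , trans (ξ-pair a y) (cong (_++ [ y ]) ξa≡xs)

theorem10 : (f : ℕ × ℕ → ℕ) (pf : IsPairing f) (md : MaxDominating f) →
    Bijective {A = ℕ} {B = List ℕ} _≡_ _≡_ (ξ_ f pf md)
theorem10 f pf md =
  (λ {a} {b} → ξ-injective a b) ,
  strictlySurjective⇒surjective (λ xs → ξ-hits (reverseView xs))
  where open Enumeration f pf md
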